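{- Let $G$ be an undirected graph. Then \[\overset{\rightarrow}{\gamma}_{LD}(G)=\min\{\gamma_{LD}(H)\mid H\text{ is a spanning subgraph of }G\}.\]
   Context: A spanning subgraph $H$ of $G$ has $V(H)=V(G)$ and $E(H)\subseteq E(G)$. For an undirected graph $G=(V,E)$, $S\subseteq V$ is a locating-dominating set if every $u\notin S$ has $N(u)\cap S\neq\emptyset$ and distinct $u,v\notin S$ satisfy $N(u)\cap S\neq N(v)\cap S$; $\gamma_{LD}(G)$ is the minimum size. For an orientation $D$ of $G$ (each edge given exactly one direction), $S$ is locating-dominating in $D$ if the same holds with $N(\cdot)$ replaced by the in-neighbourhood $N^-_D(\cdot)$; $\gamma_{LD}(D)$ is the minimum size. $\overset{\rightarrow}{\gamma}_{LD}(G)=\min_D\gamma_{LD}(D)$ over all orientations $D$ of $G$. -}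

module Defs where

open import Data.Nat using (ℕ; _≤_)
open import Data.Bool using (Bool; true; false)
open import Data.Fin using (Fin)
open import Data.Fin.Subset using (Subset; _∈_; _∉_; ∣_∣)
open import Data.Product using (Σ; ∃; _×_; _,_)
open import Data.Sum using (_⊎_)
open import Relation.Nullary using (¬_)
open import Relation.Binary.PropositionalEquality using (_≡_)

record Graph (n : ℕ) : Set where
  field
    adj    : Fin n → Fin n → Bool
    sym    : ∀ u v → adj u v ≡ adj v u
    irrefl : ∀ u → adj u u ≡ false
open Graph public

-- A (directed) relation on Fin n: R v u ≡ true means v is an in-neighbour of u
-- (for an undirected graph: v is a neighbour of u).
Rel : ℕ → Set
Rel n = Fin n → Fin n → Bool

IsLD : ∀ {n} → Rel n → Subset n → Set
IsLD {n} R S =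
  (∀ (u : Fin n) → u ∉ S → ∃ λ w → w ∈ S × R w u ≡ true) ×
  (∀ (u v : Fin n) → u ∉ S → v ∉ S → ¬ (u ≡ v) →
     ¬ (∀ w → w ∈ S → R w u ≡ R w v))

IsγLD : ∀ {n} → Rel n → ℕ → Set
IsγLD R k = (∃ λ S → IsLD R S × ∣ S ∣ ≡ k) × (∀ S → IsLD R S → k ≤ ∣ S ∣)

IsOrientation : ∀ {n} → Graph n → Rel n → Set
IsOrientation {n} G D =
  (∀ (u v : Fin n) → D u v ≡ true → adj G u v ≡ true) ×
  (∀ (u v : Fin n) → adj G u v ≡ true →
     (D u v ≡ true × D v u ≡ false) ⊎ (D u v ≡ false × D v u ≡ true))

IsSpanningSubgraph : ∀ {n} → Graph n → Graph n → Set
IsSpanningSubgraph {n} H G = ∀ (u v : Fin n) → adj H u v ≡ true → adj G u v ≡ true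

IsOrientedγLD : ∀ {n} → Graph n → ℕ → Set
IsOrientedγLD G k =
  (∃ λ D → IsOrientation G D × IsγLD D k) ×
  (∀ D m → IsOrientation G D → IsγLD D m → k ≤ m)

IsMinSpanningγLD : ∀ {n} → Graph n → ℕ → Set
IsMinSpanningγLD G k =
  (∃ λ H → IsSpanningSubgraph H G × IsγLD (adj H) k) ×
  (∀ H m → IsSpanningSubgraph H G → IsγLD (adj H) m → k ≤ m)

{-# OPTIONS --safe #-}
-- Whether S is locating-dominating for a relation R depends only on the arcs
-- of R leaving S. Given an orientation D of G and a set S, the undirected
-- edges underlying the arcs of D that leave S form a spanning subgraph H with
-- the same arcs out of S. Conversely, given a spanning subgraph H and S, orient
-- every edge of G between S and its complement out of S if it lies in H and
-- into S otherwise (and all other edges arbitrarily); again the arcs out of S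
-- are those of H. So both families have the same locating-dominating sets up
-- to this matching, and hence the same minimum.
module Submission where

open import Defs
open import Function using (id)
open import Data.Nat using (ℕ; zero; suc; _≤_; z≤n; s≤s; _≟_)
open import Data.Nat.Properties using (≤-trans; ≤-reflexive)
open import Data.Product using (_×_; _,_; ∃; Σ; proj₁; proj₂)
open import Data.Sum using (_⊎_; inj₁; inj₂)
open import Data.Bool using (Bool; true; false; _∧_; _∨_; not; if_then_else_)
open import Data.Bool.Properties using (∨-comm; ∨-identityʳ; ∧-zeroʳ; not-involutive)
  renaming (_≟_ to _≟ᵇ_)
open import Data.Fin using (Fin)
open import Data.Fin.Properties using (<-cmp; any?; all?) renaming (_≟_ to _≟ᶠ_)
open import Data.Fin.Subset using (Subset; _∈_; _∉_; ∣_∣; ⊤)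
open import Data.Fin.Subset.Properties using (_∈?_; anySubset?; ∈⊤)
open import Data.Vec using (lookup)
open import Data.Vec.Properties using ([]=⇒lookup; lookup⇒[]=)
open import Data.Empty using (⊥-elim)
open import Relation.Nullary using (Dec; yes; no)
open import Relation.Nullary.Decidable using (¬?; _×-dec_; _→-dec_)
open import Relation.Binary using (tri<; tri≈; tri>)
open import Relation.Binary.PropositionalEquality
  using (_≡_; _≢_; refl; trans) renaming (sym to ≡-sym)

private
  variable
    n : ℕ

∈⇒lookup≡true : (S : Subset n) {u : Fin n} → u ∈ S → lookup S u ≡ true
∈⇒lookup≡true S = []=⇒lookup

∉⇒lookup≡false : (S : Subset n) {u : Fin n} → u ∉ S → lookup S u ≡ false
∉⇒lookup≡false S {u} u∉S with lookup S u in eq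
... | true  = ⊥-elim (u∉S (lookup⇒[]= u S eq))
... | false = refl

adj⇒≢ : (G : Graph n) {u v : Fin n} → adj G u v ≡ true → u ≢ v
adj⇒≢ G {u} e refl with trans (≡-sym e) (irrefl G u)
... | ()

AgreeOutOf : Subset n → Rel n → Rel n → Set
AgreeOutOf {n} S R R′ = ∀ (w u : Fin n) → w ∈ S → u ∉ S → R w u ≡ R′ w u

IsLD-agreeOutOf : ∀ {S} {R R′ : Rel n} → AgreeOutOf S R R′ → IsLD R S → IsLD R′ S
IsLD-agreeOutOf agree (dominating , locating) =
  (λ u u∉S → let (w , w∈S , Rwu) = dominating u u∉S
             in w , w∈S , trans (≡-sym (agree w u w∈S u∉S)) Rwu) ,
  (λ u v u∉S v∉S u≢v sameTrace → locating u v u∉S v∉S u≢v λ w w∈S →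
     trans (agree w u w∈S u∉S) (trans (sameTrace w w∈S) (≡-sym (agree w v w∈S v∉S))))

IsLD? : (R : Rel n) (S : Subset n) → Dec (IsLD R S)
IsLD? R S =
  all? (λ u → ¬? (u ∈? S) →-dec any? (λ w → (w ∈? S) ×-dec (R w u ≟ᵇ true))) ×-dec
  all? (λ u → all? (λ v → ¬? (u ∈? S) →-dec ¬? (v ∈? S) →-dec ¬? (u ≟ᶠ v) →-dec
    ¬? (all? (λ w → (w ∈? S) →-dec (R w u ≟ᵇ R w v)))))

least-satisfying : (P : ℕ → Set) → (∀ c → Dec (P c)) → ∀ {N} → P N →
                   Σ ℕ λ m → P m × (∀ j → P j → m ≤ j)
least-satisfying P P? pN with P? 0
... | yes p0 = 0 , p0 , λ _ _ → z≤n
least-satisfying P P? {zero}  p0 | no ¬p0 = ⊥-elim (¬p0 p0)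
least-satisfying P P? {suc N} pN | no ¬p0
  with least-satisfying (λ c → P (suc c)) (λ c → P? (suc c)) pN
... | m , pm , least = suc m , pm , λ where
  zero    p0 → ⊥-elim (¬p0 p0)
  (suc j) pj → s≤s (least j pj)

⊤-isLD : (R : Rel n) → IsLD R ⊤
⊤-isLD R = (λ u u∉⊤ → ⊥-elim (u∉⊤ ∈⊤)) , (λ u v u∉⊤ _ _ _ → u∉⊤ ∈⊤)

γLD-exists : (R : Rel n) → ∃ λ m → IsγLD R m
γLD-exists R
  with least-satisfying (λ c → ∃ λ S → IsLD R S × ∣ S ∣ ≡ c)
         (λ c → anySubset? λ S → IsLD? R S ×-dec (∣ S ∣ ≟ c))
         (⊤ , ⊤-isLD R , refl)
... | m , pm , least = m , pm , λ S S-LD → least ∣ S ∣ (S , S-LD , refl)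

-- IsOrientedγLD G and IsMinSpanningγLD G are, definitionally,
-- IsMinγLD (IsOrientation G) id and IsMinγLD (λ H → IsSpanningSubgraph H G) adj.
IsMinγLD : {I : Set} → (I → Set) → (I → Rel n) → ℕ → Set
IsMinγLD P ρ k =
  (∃ λ i → P i × IsγLD (ρ i) k) × (∀ i m → P i → IsγLD (ρ i) m → k ≤ m)

Simulates : {I J : Set} → (I → Set) → (I → Rel n) → (J → Set) → (J → Rel n) → Set
Simulates {n} P ρ Q σ =
  ∀ i → P i → (S : Subset n) → ∃ λ j → Q j × AgreeOutOf S (ρ i) (σ j)

IsMinγLD-lowerBound : {I J : Set} {P : I → Set} {ρ : I → Rel n}
                      {Q : J → Set} {σ : J → Rel n} {k : ℕ} →
                      Simulates Q σ P ρ → (∀ i m → P i → IsγLD (ρ i) m → k ≤ m) →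
                      ∀ j → Q j → ∀ S → IsLD (σ j) S → k ≤ ∣ S ∣
IsMinγLD-lowerBound {ρ = ρ} QbyP lower j Qj S S-LD with QbyP j Qj S
... | i , Pi , agree =
  let (m , γ) = γLD-exists (ρ i)
  in ≤-trans (lower i m Pi γ) (proj₂ γ S (IsLD-agreeOutOf agree S-LD))

IsMinγLD-transfer : {I J : Set} {P : I → Set} {ρ : I → Rel n}
                    {Q : J → Set} {σ : J → Rel n} {k : ℕ} →
                    Simulates P ρ Q σ → Simulates Q σ P ρ →
                    IsMinγLD P ρ k → IsMinγLD Q σ k
IsMinγLD-transfer {Q = Q} {σ} {k} PbyQ QbyP ((i , Pi , (S₀ , S₀-LD , ∣S₀∣≡k) , _) , lower)
  with PbyQ i Pi S₀
... | j₀ , Qj₀ , agree₀ =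
  (j₀ , Qj₀ , (S₀ , IsLD-agreeOutOf agree₀ S₀-LD , ∣S₀∣≡k) , k≤LD j₀ Qj₀) ,
  λ j m Qj γ → let (S , S-LD , ∣S∣≡m) = proj₁ γ
               in ≤-trans (k≤LD j Qj S S-LD) (≤-reflexive ∣S∣≡m)
  where
  k≤LD : ∀ j → Q j → ∀ S → IsLD (σ j) S → k ≤ ∣ S ∣
  k≤LD = IsMinγLD-lowerBound QbyP lower

arcsOutOf : Subset n → Rel n → Rel n
arcsOutOf S R u v = lookup S u ∧ (not (lookup S v) ∧ R u v)

arcsOutOf⇒arc : (S : Subset n) (R : Rel n) (u v : Fin n) →
                arcsOutOf S R u v ≡ true → R u v ≡ true
arcsOutOf⇒arc S R u v e with lookup S u | lookup S v
arcsOutOf⇒arc S R u v e  | true  | false = e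
arcsOutOf⇒arc S R u v () | true  | true
arcsOutOf⇒arc S R u v () | false | _

underlying : (R : Rel n) → (∀ u → R u u ≡ false) → Graph n
underlying R R-irrefl = record
  { adj    = λ u v → R u v ∨ R v u
  ; sym    = λ u v → ∨-comm (R u v) (R v u)
  ; irrefl = loopless
  }
  where loopless : ∀ u → R u u ∨ R u u ≡ false
        loopless u rewrite R-irrefl u = refl

underlying-spanning : {R : Rel n} {R-irrefl : ∀ u → R u u ≡ false} (G : Graph n) →
                      (∀ u v → R u v ≡ true → adj G u v ≡ true) →
                      IsSpanningSubgraph (underlying R R-irrefl) G
underlying-spanning {R = R} G R⊆G u v e with R u v in Ruv | R v u in Rvu
... | true  | _     = R⊆G u v Ruv
... | false | true  = trans (Graph.sym G u v) (R⊆G v u Rvu)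

arcsOutOf-irrefl : (S : Subset n) (R : Rel n) (u : Fin n) → arcsOutOf S R u u ≡ false
arcsOutOf-irrefl S R u with lookup S u
... | true  = refl
... | false = refl

orientations-simulate-subgraphs :
  (G : Graph n) → Simulates (IsOrientation G) id (λ H → IsSpanningSubgraph H G) adj
orientations-simulate-subgraphs G D (D⊆G , _) S =
  underlying (arcsOutOf S D) (arcsOutOf-irrefl S D) ,
  underlying-spanning {R-irrefl = arcsOutOf-irrefl S D} G
    (λ u v e → D⊆G u v (arcsOutOf⇒arc S D u v e)) ,
  agree
  where
  agree : AgreeOutOf S D (λ u v → arcsOutOf S D u v ∨ arcsOutOf S D v u)
  agree w u w∈S u∉S rewrite ∈⇒lookup≡true S w∈S | ∉⇒lookup≡false S u∉S =
    ≡-sym (∨-identityʳ (D w u))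

IsTournament : Rel n → Set
IsTournament {n} f = ∀ (u v : Fin n) → u ≢ v → f u v ≡ not (f v u)

orientBy : Graph n → Rel n → Rel n
orientBy G f u v = adj G u v ∧ f u v

orientBy-isOrientation : (G : Graph n) {f : Rel n} → IsTournament f →
                         IsOrientation G (orientBy G f)
orientBy-isOrientation G {f} f-tournament = arcs⊆edges , oneDirection
  where
  arcs⊆edges : ∀ u v → orientBy G f u v ≡ true → adj G u v ≡ true
  arcs⊆edges u v e with adj G u v
  ... | true = refl

  oneDirection : ∀ u v → adj G u v ≡ true →
                 (orientBy G f u v ≡ true  × orientBy G f v u ≡ false) ⊎
                 (orientBy G f u v ≡ false × orientBy G f v u ≡ true)
  oneDirection u v e
    rewrite e | trans (Graph.sym G v u) e | f-tournament u v (adj⇒≢ G e)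
    with f v u
  ... | true  = inj₂ (refl , refl)
  ... | false = inj₁ (refl , refl)

precedes : Fin n → Fin n → Bool
precedes u v with <-cmp u v
... | tri< _ _ _ = true
... | tri≈ _ _ _ = false
... | tri> _ _ _ = false

precedes-tournament : IsTournament {n} precedes
precedes-tournament u v u≢v with <-cmp u v | <-cmp v u
... | tri< u<v _ _ | tri< _ _ u<v′ = ⊥-elim (u<v′ u<v)
... | tri< _ _ _   | tri≈ _ v≡u _ = ⊥-elim (u≢v (≡-sym v≡u))
... | tri< _ _ _   | tri> _ _ _   = refl
... | tri≈ _ u≡v _ | _            = ⊥-elim (u≢v u≡v)
... | tri> _ _ _   | tri< _ _ _   = refl
... | tri> _ _ _   | tri≈ _ v≡u _ = ⊥-elim (u≢v (≡-sym v≡u))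
... | tri> _ _ v<u | tri> v<u′ _ _ = ⊥-elim (v<u′ v<u)

-- Between S and its complement, point out of S exactly along the edges of H.
cutTournament : Subset n → Graph n → Rel n
cutTournament S H u v =
  if lookup S u then (if lookup S v then precedes u v else adj H u v)
                else (if lookup S v then not (adj H v u) else precedes u v)

cutTournament-tournament : (S : Subset n) (H : Graph n) → IsTournament (cutTournament S H)
cutTournament-tournament S H u v u≢v with lookup S u | lookup S v
... | true  | true  = precedes-tournament u v u≢v
... | true  | false = ≡-sym (not-involutive (adj H u v))
... | false | true  = refl
... | false | false = precedes-tournament u v u≢v

subgraphs-simulate-orientations :
  (G : Graph n) → Simulates (λ H → IsSpanningSubgraph H G) adj (IsOrientation G) id
subgraphs-simulate-orientations G H H⊆G S =
  orientBy G (cutTournament S H) ,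
  orientBy-isOrientation G (cutTournament-tournament S H) ,
  agree
  where
  agree : AgreeOutOf S (adj H) (orientBy G (cutTournament S H))
  agree w u w∈S u∉S rewrite ∈⇒lookup≡true S w∈S | ∉⇒lookup≡false S u∉S
    with adj H w u in e
  ... | true  rewrite H⊆G w u e = refl
  ... | false = ≡-sym (∧-zeroʳ (adj G w u))

lemma12 : (n : ℕ) (G : Graph n) (k : ℕ) →
    (IsOrientedγLD G k → IsMinSpanningγLD G k) × (IsMinSpanningγLD G k → IsOrientedγLD G k)
lemma12 n G k =
  IsMinγLD-transfer (orientations-simulate-subgraphs G) (subgraphs-simulate-orientations G) ,
  IsMinγLD-transfer (subgraphs-simulate-orientations G) (orientations-simulate-subgraphs G)
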